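{- Suppose that $M_h \sim_m M_l$, where $M_h \models \mathcal{D}_h$, $M_l \models \mathcal{D}_l \cup \mathcal{C}$, $\mathcal{D}_h$ and $\mathcal{D}_l$ are both NDBATs, and $m$ is proper wrt $\mathcal{D}_l$. Then for any high-level system action sequence $\vec{\alpha}$ and any high-level primitive action $A$, we have that: (1) if there exist $s_h$ and $s_h'$ such that $M_h,v[s/s_h,s'/s_h'] \models Do(\vec{\alpha},S_0,s) \land Do_{ag}(A(\vec{x}),s,s')$, then there exist $s_l$ and $s_l'$ such that $M_l,v[s/s_l,s'/s_l'] \models Do(m_s(\vec{\alpha}),S_0,s) \land Do_{ag}(m_a(A(\vec{x})),s,s')$, $s_h \sim_m^{M_h,M_l} s_l$, and $s_h' \sim_m^{M_h,M_l} s_l'$; (2) if there exist $s_l$ and $s_l'$ such that $M_l,v[s/s_l,s'/s_l'] \models Do(m_s(\vec{\alpha}),S_0,s) \land Do_{ag}(m_a(A(\vec{x})),s,s')$, then there exist $s_h$ and $s_h'$ such that $M_h,v[s/s_h,s'/s_h'] \models Do(\vec{\alpha},S_0,s) \land Do_{ag}(A(\vec{x}),s,s')$, $s_h \sim_m^{M_h,M_l} s_l$, and $s_h' \sim_m^{M_h,M_l} s_l'$.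
   Context: Setting: nondeterministic situation calculus. Every action function $A(\vec{x},e)$ takes an extra environment-reaction argument $e$ (sort Reaction); $A(\vec{x},e)$ is a system action and the reaction-suppressed $A(\vec{x})$ is an agent action. A nondeterministic basic action theory (NDBAT) is a basic action theory (foundational axioms, initial-situation axioms, unique-name axioms, successor state axioms for system actions, and system precondition axioms $Poss(A(\vec{x},e),s) \equiv \phi^{Poss}_A(\vec{x},e,s)$) which, for each agent action $A(\vec{x})$ with agent precondition $Poss_{ag}(A(\vec{x}),s) \doteq \phi^{agPoss}_A(\vec{x},s)$, entails reaction independence $\forall e.\, Poss(A(\vec{x},e),s) \supset Poss_{ag}(A(\vec{x}),s)$ and reaction existence $Poss_{ag}(A(\vec{x}),s) \supset \exists e.\, Poss(A(\vec{x},e),s)$. $Do_{ag}(\epsilon,s,s') \doteq s'=s$ and $Do_{ag}([A(\vec{x}),\sigma],s,s') \doteq \exists e.\, Poss(A(\vec{x},e),s) \land Do_{ag}(\sigma,do(A(\vec{x},e),s),s')$; for programs, $Do(\delta,s,s')$ means $\delta$ executed from $s$ can legally terminate in $s'$ (ConGolog semantics via Trans/Final), and $Do_{ag}$ on an agent program uses the variant semantics where an agent action $A(\vec{x})$ transitions to $do(A(\vec{x},e),s)$ for any $e$ with $Poss(A(\vec{x},e),s)$. $\mathcal{C}$ denotes the axioms defining ConGolog. $\mathcal{D}_h$ is a high-level NDBAT and $\mathcal{D}_l$ a low-level NDBAT. A refinement mapping $m=\langle m_a,m_s,m_f\rangle$ maps each high-level agent action $A(\vec{x})$ to a situation-determined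 low-level ConGolog agent program $m_a(A(\vec{x}))$, each high-level system action $A(\vec{x},e)$ to a situation-determined low-level ConGolog system program $m_s(A(\vec{x},e))$, and each high-level fluent $F(\vec{x})$ to a low-level situation-suppressed formula $m_f(F(\vec{x}))$; $m_a$, $m_s$ extend to sequences by sequential composition. $m$ is proper wrt $\mathcal{D}_l$ if for every high-level system action sequence $\vec{\alpha}$ and every high-level action $A$: $\mathcal{D}_l \cup \mathcal{C} \models \forall s.(Do(m_s(\vec{\alpha}),S_0,s) \supset \forall \vec{x},s'.(Do_{ag}(m_a(A(\vec{x})),s,s') \equiv \exists e.\, Do(m_s(A(\vec{x},e)),s,s')))$. Situations $s_h$ in $M_h$ and $s_l$ in $M_l$ are $m$-isomorphic, $s_h \sim_m^{M_h,M_l} s_l$, iff for every high-level fluent $F$ and assignment $v$, $M_h,v[s/s_h] \models F(\vec{x},s)$ iff $M_l,v[s/s_l] \models m_f(F(\vec{x}))[s]$. A relation $B$ between situations of $M_h$ and $M_l$ is an $m$-bisimulation if $\langle s_h,s_l\rangle \in B$ implies (i) $s_h \sim_m^{M_h,M_l} s_l$; (ii) for every high-level system action $A(\vec{x},e)$, if $M_h,v[s/s_h,s'/s_h'] \models Poss(A(\vec{x},e),s) \land s'=do(A(\vec{x},e),s)$ then there is $s_l'$ with $M_l,v[s/s_l,s'/s_l'] \models Do(m_s(A(\vec{x},e)),s,s')$ and $\langle s_h',s_l'\rangle \in B$; (iii) conversely, if $M_l,v[s/s_l,s'/s_l'] \models Do(m_s(A(\vec{x},e)),s,s')$ then there is $s_h'$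 with $M_h,v[s/s_h,s'/s_h'] \models Poss(A(\vec{x},e),s) \land s'=do(A(\vec{x},e),s)$ and $\langle s_h',s_l'\rangle \in B$. $M_h \sim_m M_l$ iff some $m$-bisimulation relates $S_0^{M_h}$ and $S_0^{M_l}$. $v[x/e]$ is the assignment like $v$ but mapping $x$ to $e$. -}

module Defs where

open import Data.Nat using (ℕ)
open import Data.Vec using (Vec)
open import Data.List using (List; []; _∷_)
open import Data.Product using (Σ; _×_; _,_)
open import Relation.Binary.PropositionalEquality using (_≡_)
open import Relation.Nullary using (¬_)

_⟺_ : Set → Set → Set
P ⟺ Q = (P → Q) × (Q → P)

-- The high-level vocabulary together with the domains of the sorts that the
-- shared variable assignment v ranges over (objects and reactions).  Both
-- M_h and M_l interpret the variables x⃗ and e over these same domains.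
record Signature : Set₁ where
  field
    Obj       : Set
    Reaction  : Set
    ActSym    : Set
    actArity  : ActSym → ℕ
    FluSym    : Set
    fluArity  : FluSym → ℕ

  -- agent action A(x⃗)  (reaction suppressed)
  AgAct : Set
  AgAct = Σ ActSym (λ A → Vec Obj (actArity A))

  SysAct : Set
  SysAct = AgAct × Reaction

open Signature public

record HModel (Sg : Signature) : Set₁ where
  field
    Sit    : Set
    S₀     : Sit
    doₛ    : SysAct Sg → Sit → Sit
    Poss   : SysAct Sg → Sit → Set
    PossAg : AgAct Sg → Sit → Set
    Holds  : (F : FluSym Sg) → Vec (Obj Sg) (fluArity Sg F) → Sit → Set

  DoSeq : List (SysAct Sg) → Sit → Sit → Set
  DoSeq []       s s' = s' ≡ s
  DoSeq (α ∷ αs) s s' = Poss α s × DoSeq αs (doₛ α s) s'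

  DoAg : AgAct Sg → Sit → Sit → Set
  DoAg a s s' = Σ (Reaction Sg) λ e → Poss (a , e) s × (s' ≡ doₛ (a , e) s)

-- The model-theoretic content of M_h ⊨ D_h that holds for every NDBAT:
-- foundational (unique-names for situations) and the NDBAT conditions.
record IsNDBATModel {Sg : Signature} (M : HModel Sg) : Set where
  open HModel M
  field
    do-injective : ∀ α β s t → doₛ α s ≡ doₛ β t → (α ≡ β) × (s ≡ t)
    S₀≢do        : ∀ α s → ¬ (S₀ ≡ doₛ α s)
    reaction-independence : ∀ a s e → Poss (a , e) s → PossAg a s
    reaction-existence    : ∀ a s → PossAg a s → Σ (Reaction Sg) λ e → Poss (a , e) s

-- A low-level model M_l together with the denotations (in M_l, under the
-- assignment v) of the images of the refinement mapping m = ⟨m_a,m_s,m_f⟩: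
--   DoMs α s s'   ⇔  M_l ⊨ Do(m_s(α),s,s')
--   DoAgMa a s s' ⇔  M_l ⊨ Do_ag(m_a(a),s,s')
--   MF F x⃗ s      ⇔  M_l ⊨ m_f(F(x⃗))[s]
record LModelMapped (Sg : Signature) : Set₁ where
  field
    Sit    : Set
    S₀     : Sit
    DoMs   : SysAct Sg → Sit → Sit → Set
    DoAgMa : AgAct Sg → Sit → Sit → Set
    MF     : (F : FluSym Sg) → Vec (Obj Sg) (fluArity Sg F) → Sit → Set

  -- Do(m_s(α⃗),s,s'): m_s on sequences is sequential composition; in ConGolog
  -- Do(nil,s,s') ≡ s'=s and Do(δ₁;δ₂,s,s') ≡ ∃s''. Do(δ₁,s,s'') ∧ Do(δ₂,s'',s').
  DoMsSeq : List (SysAct Sg) → Sit → Sit → Set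
  DoMsSeq []       s s' = s' ≡ s
  DoMsSeq (α ∷ αs) s s' = Σ Sit λ s'' → DoMs α s s'' × DoMsSeq αs s'' s'

module _ {Sg : Signature} where

  Proper : LModelMapped Sg → Set
  Proper Ml = ∀ (αs : List (SysAct Sg)) s → DoMsSeq αs S₀ s →
      ∀ (a : AgAct Sg) s' → DoAgMa a s s' ⟺ Σ (Reaction Sg) (λ e → DoMs (a , e) s s')
    where open LModelMapped Ml

  MIso : (Mh : HModel Sg) (Ml : LModelMapped Sg) → HModel.Sit Mh → LModelMapped.Sit Ml → Set
  MIso Mh Ml sh sl = ∀ (F : FluSym Sg) (xs : Vec (Obj Sg) (fluArity Sg F)) →
      HModel.Holds Mh F xs sh ⟺ LModelMapped.MF Ml F xs sl

  IsMBisim : (Mh : HModel Sg) (Ml : LModelMapped Sg) →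
             (HModel.Sit Mh → LModelMapped.Sit Ml → Set) → Set
  IsMBisim Mh Ml B = ∀ sh sl → B sh sl →
      MIso Mh Ml sh sl
    × (∀ (α : SysAct Sg) sh' → HModel.Poss Mh α sh → sh' ≡ HModel.doₛ Mh α sh →
         Σ (LModelMapped.Sit Ml) λ sl' → LModelMapped.DoMs Ml α sl sl' × B sh' sl')
    × (∀ (α : SysAct Sg) sl' → LModelMapped.DoMs Ml α sl sl' →
         Σ (HModel.Sit Mh) λ sh' → (HModel.Poss Mh α sh × sh' ≡ HModel.doₛ Mh α sh) × B sh' sl')

  MBisimilar : HModel Sg → LModelMapped Sg → Set₁
  MBisimilar Mh Ml = Σ (HModel.Sit Mh → LModelMapped.Sit Ml → Set) λ B →
      IsMBisim Mh Ml B × B (HModel.S₀ Mh) (LModelMapped.S₀ Ml)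

-- An m-bisimulation relates the end points of corresponding runs of α⃗ and
-- m_s(α⃗), and relates one step of a high-level system action A(x⃗,e) with a
-- run of m_s(A(x⃗,e)).  Properness of m turns the latter into a run of
-- m_a(A(x⃗)) at every situation reachable by m_s(α⃗), and conversely; since
-- related situations are m-isomorphic, both directions follow.
module Submission where

open import Defs
open import Data.List using (List; []; _∷_)
open import Data.Product using (Σ; _×_; _,_; proj₁; proj₂)
open import Relation.Binary.PropositionalEquality using (_≡_; refl)

module _ {Sg : Signature} (Mh : HModel Sg) (Ml : LModelMapped Sg)
            (B : HModel.Sit Mh → LModelMapped.Sit Ml → Set)
            (isB : IsMBisim Mh Ml B) where

  private
    module H = HModel Mh
    module L = LModelMapped Ml

  related⇒MIso : ∀ {sh sl} → B sh sl → MIso Mh Ml sh sl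
  related⇒MIso {sh} {sl} b = proj₁ (isB sh sl b)

  forth : ∀ {sh sl} → B sh sl → ∀ α → H.Poss α sh →
          Σ L.Sit λ sl' → L.DoMs α sl sl' × B (H.doₛ α sh) sl'
  forth {sh} {sl} b α p = proj₁ (proj₂ (isB sh sl b)) α (H.doₛ α sh) p refl

  back : ∀ {sh sl} → B sh sl → ∀ α {sl'} → L.DoMs α sl sl' →
         Σ H.Sit λ sh' → (H.Poss α sh × sh' ≡ H.doₛ α sh) × B sh' sl'
  back {sh} {sl} b α d = proj₂ (proj₂ (isB sh sl b)) α _ d

  DoSeq⇒DoMsSeq : ∀ αs {sh₀ sl₀ sh} → B sh₀ sl₀ → H.DoSeq αs sh₀ sh →
                  Σ L.Sit λ sl → L.DoMsSeq αs sl₀ sl × B sh sl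
  DoSeq⇒DoMsSeq []       {sl₀ = sl₀} b refl = sl₀ , refl , b
  DoSeq⇒DoMsSeq (α ∷ αs) b (p , run) with forth b α p
  ... | sl₁ , step , b₁ with DoSeq⇒DoMsSeq αs b₁ run
  ... | sl , run' , b' = sl , (sl₁ , step , run') , b'

  DoMsSeq⇒DoSeq : ∀ αs {sh₀ sl₀ sl} → B sh₀ sl₀ → L.DoMsSeq αs sl₀ sl →
                  Σ H.Sit λ sh → H.DoSeq αs sh₀ sh × B sh sl
  DoMsSeq⇒DoSeq []       {sh₀} b refl = sh₀ , refl , b
  DoMsSeq⇒DoSeq (α ∷ αs) b (sl₁ , step , run) with back b α step
  ... | sh₁ , (p , refl) , b₁ with DoMsSeq⇒DoSeq αs b₁ run
  ... | sh , run' , b' = sh , (p , run') , b'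

  DoAg⇒DoMs : ∀ a {sh sl sh'} → B sh sl → H.DoAg a sh sh' →
              Σ L.Sit λ sl' → Σ (Reaction Sg) (λ e → L.DoMs (a , e) sl sl') × B sh' sl'
  DoAg⇒DoMs a b (e , p , refl) with forth b (a , e) p
  ... | sl' , step , b' = sl' , (e , step) , b'

  DoMs⇒DoAg : ∀ a e {sh sl sl'} → B sh sl → L.DoMs (a , e) sl sl' →
              Σ H.Sit λ sh' → H.DoAg a sh sh' × B sh' sl'
  DoMs⇒DoAg a e b step with back b (a , e) step
  ... | sh' , (p , eq) , b' = sh' , (e , p , eq) , b'

  module _ (proper : Proper Ml) (b₀ : B H.S₀ L.S₀) (αs : List (SysAct Sg)) (a : AgAct Sg) where

    high-run⇒low-run : ∀ {sh sh'} → H.DoSeq αs H.S₀ sh → H.DoAg a sh sh' →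
      Σ L.Sit λ sl → Σ L.Sit λ sl' → L.DoMsSeq αs L.S₀ sl × L.DoAgMa a sl sl'
        × MIso Mh Ml sh sl × MIso Mh Ml sh' sl'
    high-run⇒low-run run ag with DoSeq⇒DoMsSeq αs b₀ run
    ... | sl , run' , b with DoAg⇒DoMs a b ag
    ... | sl' , sys , b' =
      sl , sl' , run' , proj₂ (proper αs sl run' a sl') sys , related⇒MIso b , related⇒MIso b'

    low-run⇒high-run : ∀ {sl sl'} → L.DoMsSeq αs L.S₀ sl → L.DoAgMa a sl sl' →
      Σ H.Sit λ sh → Σ H.Sit λ sh' → H.DoSeq αs H.S₀ sh × H.DoAg a sh sh'
        × MIso Mh Ml sh sl × MIso Mh Ml sh' sl'
    low-run⇒high-run {sl} {sl'} run ag with DoMsSeq⇒DoSeq αs b₀ run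
    ... | sh , run' , b with proj₁ (proper αs sl run a sl') ag
    ... | e , step with DoMs⇒DoAg a e b step
    ... | sh' , ag' , b' = sh , sh' , run' , ag' , related⇒MIso b , related⇒MIso b'

theorem1 : (Sg : Signature) (Mh : HModel Sg) (Ml : LModelMapped Sg) →
    IsNDBATModel Mh → Proper Ml → MBisimilar Mh Ml →
    ∀ (αs : List (SysAct Sg)) (a : AgAct Sg) →
      (∀ sh sh' → HModel.DoSeq Mh αs (HModel.S₀ Mh) sh → HModel.DoAg Mh a sh sh' →
        Σ (LModelMapped.Sit Ml) λ sl → Σ (LModelMapped.Sit Ml) λ sl' →
          LModelMapped.DoMsSeq Ml αs (LModelMapped.S₀ Ml) sl × LModelMapped.DoAgMa Ml a sl sl'
          × MIso Mh Ml sh sl × MIso Mh Ml sh' sl')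
    × (∀ sl sl' → LModelMapped.DoMsSeq Ml αs (LModelMapped.S₀ Ml) sl → LModelMapped.DoAgMa Ml a sl sl' →
        Σ (HModel.Sit Mh) λ sh → Σ (HModel.Sit Mh) λ sh' →
          HModel.DoSeq Mh αs (HModel.S₀ Mh) sh × HModel.DoAg Mh a sh sh'
          × MIso Mh Ml sh sl × MIso Mh Ml sh' sl')
theorem1 Sg Mh Ml _ proper (B , isB , b₀) αs a =
    (λ _ _ → high-run⇒low-run Mh Ml B isB proper b₀ αs a)
  , (λ _ _ → low-run⇒high-run Mh Ml B isB proper b₀ αs a)
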